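{- Let $d\geq 2$, let $\alpha_1,\dots,\alpha_d\in\mathbb Z$ with $\alpha_d\neq0$, and let $s\in\mathbb N^{\mathbb N}$ satisfy $s(n+d)+\alpha_1 s(n+d-1)+\dots+\alpha_d s(n)=0$ for all $n\geq 0$. Let $B_s(X)=\alpha_d+\alpha_{d-1}X+\dots+\alpha_1X^{d-1}+X^d$ and $S_k(X)=s(k)+s(k-1)X+\dots+s(0)X^k$. For every natural number $k\geq d-1$ let $$C_k(X)=c_0(k)+c_1(k)X+\dots+c_{d-1}(k)X^{d-1}$$ be the polynomial $C_k(X)=B_s(X)S_k(X)\bmod X^d$ (i.e. the sum of the terms of degree $<d$ of $B_s(X)S_k(X)$). Then there exists $b\in\mathbb N$ such that $|c_i(k)|<b^{k/3}$ for all $i\in\{0,1,\dots,d-1\}$ and all $k\geq d-1$.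
   Context: $\mathbb N=\{0,1,2,\dots\}$. -}

module Defs where

open import Data.Nat as ℕ using (ℕ; zero; suc; _∸_; _≟_; _<?_)
open import Data.Integer as ℤ using (ℤ; +_; 0ℤ; 1ℤ; _+_; _*_)
open import Relation.Nullary using (yes; no)
open import Relation.Binary.PropositionalEquality using (_≡_)

sumℤ : ℕ → (ℕ → ℤ) → ℤ
sumℤ zero    f = 0ℤ
sumℤ (suc n) f = sumℤ n f + f n

-- The recurrence  s(n+d) + α₁ s(n+d-1) + … + α_d s(n) = 0  for all n.
-- α j stands for α_j (only j ∈ {1,…,d} are used).
Recurrence : (d : ℕ) → (α : ℕ → ℤ) → (s : ℕ → ℕ) → Set
Recurrence d α s =
  ∀ n → + s (n ℕ.+ d) + sumℤ d (λ j → α (suc j) * + s (n ℕ.+ d ∸ suc j)) ≡ 0ℤ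

Bcoef : (d : ℕ) → (α : ℕ → ℤ) → ℕ → ℤ
Bcoef d α j with j ≟ d
... | yes _ = 1ℤ
... | no _ with j <? d
...   | yes _ = α (d ∸ j)
...   | no _  = 0ℤ

Scoef : (s : ℕ → ℕ) → (k : ℕ) → ℕ → ℤ
Scoef s k m with m ℕ.≤? k
... | yes _ = + s (k ∸ m)
... | no _  = 0ℤ

mulCoef : (ℕ → ℤ) → (ℕ → ℤ) → ℕ → ℤ
mulCoef f g i = sumℤ (suc i) (λ j → f j * g (i ∸ j))

-- c_i(k) : coefficient of X^i in B_s(X) S_k(X)  (for i < d this is the
-- coefficient of X^i of C_k(X) = B_s(X) S_k(X) mod X^d)
c : (d : ℕ) → (α : ℕ → ℤ) → (s : ℕ → ℕ) → (i k : ℕ) → ℤ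
c d α s i k = mulCoef (Bcoef d α) (Scoef s k) i

{-# OPTIONS --safe #-}
-- The sequence s grows at most exponentially: solving the recurrence for s(m) bounds it by
-- d · max|αⱼ| · max_{n<m} s(n), so s(m) ≤ K Lᵐ with K = max_{n<d} s(n) and L = 1 + d · max|αⱼ|.
-- Each c_i(k) is a sum of at most d products of a coefficient of B_s (bounded independently of k)
-- and some s(n) with n ≤ k, hence |c_i(k)| ≤ Mᵏ for k ≥ 1, and |c_i(k)|³ ≤ (M³)ᵏ < (M³ + 1)ᵏ.
module Submission where

open import Defs
open import Data.Nat using (ℕ; _≤_; _<_; _∸_; _^_)
open import Data.Integer using (ℤ; ∣_∣; 0ℤ)
open import Data.Product using (∃)
open import Relation.Binary.PropositionalEquality using (_≢_)

open import Data.Nat as ℕ using (zero; suc; z≤n; s≤s; _⊔_; _<?_; _≟_; NonZero; >-nonZero)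
open import Data.Nat.Properties
open import Data.Nat.Induction using (<-rec)
open import Data.Integer as ℤ using (+_)
import Data.Integer.Properties as ℤ
open import Algebra.Properties.AbelianGroup ℤ.+-0-abelianGroup using (inverseˡ-unique)
open import Algebra.Properties.CommutativeSemigroup *-commutativeSemigroup using (x∙yz≈y∙xz)
open import Data.Product using (_,_)
open import Data.Sum using (inj₁; inj₂)
open import Relation.Nullary using (yes; no; contradiction)
open import Relation.Binary.PropositionalEquality using (_≡_; refl; sym; trans; cong; subst)

initial-segment-bounded : ∀ n (f : ℕ → ℕ) → ∃ λ B → ∀ j → j ≤ n → f j ≤ B
initial-segment-bounded zero    f = f 0 , λ { zero z≤n → ≤-refl }
initial-segment-bounded (suc n) f with initial-segment-bounded n f
... | B , f≤B = B ⊔ f (suc n) , bound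
  where
  bound : ∀ j → j ≤ suc n → f j ≤ B ⊔ f (suc n)
  bound j j≤1+n with m≤n⇒m<n∨m≡n j≤1+n
  ... | inj₁ j<1+n = m≤n⇒m≤n⊔o (f (suc n)) (f≤B j (≤-pred j<1+n))
  ... | inj₂ refl  = m≤n⊔m B (f (suc n))

∣sumℤ∣≤ : ∀ n {f : ℕ → ℤ} {B} → (∀ j → j < n → ∣ f j ∣ ≤ B) → ∣ sumℤ n f ∣ ≤ n ℕ.* B
∣sumℤ∣≤ zero    _     = z≤n
∣sumℤ∣≤ (suc n) {f} {B} ∣f∣≤B = begin
  ∣ sumℤ n f ℤ.+ f n ∣     ≤⟨ ℤ.∣i+j∣≤∣i∣+∣j∣ (sumℤ n f) (f n) ⟩
  ∣ sumℤ n f ∣ ℕ.+ ∣ f n ∣ ≤⟨ +-mono-≤ (∣sumℤ∣≤ n (λ j j<n → ∣f∣≤B j (m≤n⇒m≤1+n j<n))) (∣f∣≤B n ≤-refl) ⟩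
  n ℕ.* B ℕ.+ B            ≡⟨ +-comm (n ℕ.* B) B ⟩
  suc n ℕ.* B              ∎
  where open ≤-Reasoning

∣mulCoef∣≤ : ∀ (f g : ℕ → ℤ) {F G} → (∀ j → ∣ f j ∣ ≤ F) → (∀ j → ∣ g j ∣ ≤ G) →
             ∀ i → ∣ mulCoef f g i ∣ ≤ suc i ℕ.* (F ℕ.* G)
∣mulCoef∣≤ f g ∣f∣≤F ∣g∣≤G i = ∣sumℤ∣≤ (suc i) λ j _ →
  ≤-trans (≤-reflexive (ℤ.abs-* (f j) (g (i ∸ j)))) (*-mono-≤ (∣f∣≤F j) (∣g∣≤G (i ∸ j)))

∣Bcoef∣≤ : ∀ d (α : ℕ → ℤ) {A} → (∀ t → t ≤ d → ∣ α t ∣ ≤ A) → ∀ j → ∣ Bcoef d α j ∣ ≤ suc A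
∣Bcoef∣≤ d α ∣α∣≤A j with j ≟ d
... | yes _ = s≤s z≤n
... | no _ with j <? d
...   | yes _ = m≤n⇒m≤1+n (∣α∣≤A (d ∸ j) (m∸n≤m d j))
...   | no _  = z≤n

∣Scoef∣≤ : ∀ (s : ℕ → ℕ) k {B} → (∀ n → n ≤ k → s n ≤ B) → ∀ m → ∣ Scoef s k m ∣ ≤ B
∣Scoef∣≤ s k s≤B m with m ℕ.≤? k
... | yes _ = s≤B (k ∸ m) (m∸n≤m k m)
... | no _  = z≤n

+≡0⇒∣i∣≡∣j∣ : ∀ i j → i ℤ.+ j ≡ 0ℤ → ∣ i ∣ ≡ ∣ j ∣
+≡0⇒∣i∣≡∣j∣ i j i+j≡0 = trans (cong ∣_∣ (inverseˡ-unique i j i+j≡0)) (ℤ.∣-i∣≡∣i∣ j)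

recurrence-at : ∀ {d} α s → Recurrence d α s → ∀ {m} → d ≤ m →
                + s m ℤ.+ sumℤ d (λ j → α (suc j) ℤ.* + s (m ∸ suc j)) ≡ 0ℤ
recurrence-at {d} α s rec {m} d≤m =
  subst (λ n → + s n ℤ.+ sumℤ d (λ j → α (suc j) ℤ.* + s (n ∸ suc j)) ≡ 0ℤ)
        (m∸n+n≡m d≤m) (rec (m ∸ d))

recurrence-exp-bound : ∀ {d} α s → 1 ≤ d → Recurrence d α s → ∀ {A K} →
                       (∀ t → t ≤ d → ∣ α t ∣ ≤ A) → (∀ m → m < d → s m ≤ K) →
                       ∀ m → s m ≤ K ℕ.* suc (d ℕ.* A) ^ m
recurrence-exp-bound {d} α s 1≤d rec {A} {K} ∣α∣≤A s≤K = <-rec _ step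
  where
  L : ℕ
  L = suc (d ℕ.* A)

  step : ∀ m → (∀ {n} → n < m → s n ≤ K ℕ.* L ^ n) → s m ≤ K ℕ.* L ^ m
  step m ih with m <? d
  step m ih       | yes m<d = ≤-trans (s≤K m m<d) (m≤m*n K (L ^ m) {{m^n≢0 L m}})
  step zero ih    | no 0≮d  = contradiction 1≤d 0≮d
  step (suc m) ih | no m≮d  = begin
    s (suc m)                            ≡⟨ +≡0⇒∣i∣≡∣j∣ (+ s (suc m)) S (recurrence-at α s rec (≮⇒≥ m≮d)) ⟩
    ∣ S ∣                                ≤⟨ ∣sumℤ∣≤ d term≤ ⟩
    d ℕ.* (A ℕ.* (K ℕ.* L ^ m))          ≡⟨ sym (*-assoc d A _) ⟩
    d ℕ.* A ℕ.* (K ℕ.* L ^ m)            ≤⟨ *-monoˡ-≤ (K ℕ.* L ^ m) (n≤1+n (d ℕ.* A)) ⟩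
    L ℕ.* (K ℕ.* L ^ m)                  ≡⟨ x∙yz≈y∙xz L K (L ^ m) ⟩
    K ℕ.* L ^ suc m                      ∎
    where
    open ≤-Reasoning
    S : ℤ
    S = sumℤ d (λ j → α (suc j) ℤ.* + s (m ∸ j))
    term≤ : ∀ j → j < d → ∣ α (suc j) ℤ.* + s (m ∸ j) ∣ ≤ A ℕ.* (K ℕ.* L ^ m)
    term≤ j j<d = begin
      ∣ α (suc j) ℤ.* + s (m ∸ j) ∣ ≡⟨ ℤ.abs-* (α (suc j)) (+ s (m ∸ j)) ⟩
      ∣ α (suc j) ∣ ℕ.* s (m ∸ j)   ≤⟨ *-mono-≤ (∣α∣≤A (suc j) j<d) (ih (s≤s (m∸n≤m m j))) ⟩
      A ℕ.* (K ℕ.* L ^ (m ∸ j))     ≤⟨ *-monoʳ-≤ A (*-monoʳ-≤ K (^-monoʳ-≤ L (m∸n≤m m j))) ⟩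
      A ℕ.* (K ℕ.* L ^ m)           ∎

*-^-≤-^ : ∀ m n k → .{{NonZero m}} → .{{NonZero k}} → m ℕ.* n ^ k ≤ (m ℕ.* n) ^ k
*-^-≤-^ m n (suc zero) = ≤-reflexive (trans (cong (m ℕ.*_) (*-identityʳ n)) (sym (*-identityʳ (m ℕ.* n))))
*-^-≤-^ m n (suc (suc k)) = begin
  m ℕ.* (n ℕ.* n ^ suc k)       ≡⟨ x∙yz≈y∙xz m n (n ^ suc k) ⟩
  n ℕ.* (m ℕ.* n ^ suc k)       ≤⟨ *-mono-≤ (m≤n*m n m) (*-^-≤-^ m n (suc k)) ⟩
  m ℕ.* n ℕ.* (m ℕ.* n) ^ suc k ∎
  where open ≤-Reasoning

c-exp-bound : ∀ {d} α s → 1 ≤ d → Recurrence d α s →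
              ∃ λ M → ∀ k → .{{NonZero k}} → ∀ i → i < d → ∣ c d α s i k ∣ ≤ M ^ k
c-exp-bound {d} α s 1≤d rec with initial-segment-bounded d (λ t → ∣ α t ∣) | initial-segment-bounded d s
... | A , ∣α∣≤A | K , s≤K = Q ℕ.* L , c≤
  where
  L Q : ℕ
  L = suc (d ℕ.* A)
  Q = suc (d ℕ.* (suc A ℕ.* K))

  c≤ : ∀ k → .{{NonZero k}} → ∀ i → i < d → ∣ c d α s i k ∣ ≤ (Q ℕ.* L) ^ k
  c≤ k i i<d = begin
    ∣ c d α s i k ∣                     ≤⟨ ∣mulCoef∣≤ (Bcoef d α) (Scoef s k) (∣Bcoef∣≤ d α ∣α∣≤A) (∣Scoef∣≤ s k s≤KLᵏ) i ⟩
    suc i ℕ.* (suc A ℕ.* (K ℕ.* L ^ k)) ≤⟨ *-monoˡ-≤ _ i<d ⟩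
    d ℕ.* (suc A ℕ.* (K ℕ.* L ^ k))     ≡⟨ cong (d ℕ.*_) (sym (*-assoc (suc A) K (L ^ k))) ⟩
    d ℕ.* (suc A ℕ.* K ℕ.* L ^ k)       ≡⟨ sym (*-assoc d (suc A ℕ.* K) (L ^ k)) ⟩
    d ℕ.* (suc A ℕ.* K) ℕ.* L ^ k       ≤⟨ *-monoˡ-≤ (L ^ k) (n≤1+n (d ℕ.* (suc A ℕ.* K))) ⟩
    Q ℕ.* L ^ k                         ≤⟨ *-^-≤-^ Q L k ⟩
    (Q ℕ.* L) ^ k                       ∎
    where
    open ≤-Reasoning
    s≤KLᵏ : ∀ n → n ≤ k → s n ≤ K ℕ.* L ^ k
    s≤KLᵏ n n≤k = ≤-trans (recurrence-exp-bound α s 1≤d rec ∣α∣≤A (λ m m<d → s≤K m (<⇒≤ m<d)) n)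
                          (*-monoʳ-≤ K (^-monoʳ-≤ L n≤k))

cube<pow : ∀ {x} M k → .{{NonZero k}} → x ≤ M ^ k → x ^ 3 < suc (M ^ 3) ^ k
cube<pow {x} M k x≤Mᵏ = begin-strict
  x ^ 3        ≤⟨ ^-monoˡ-≤ 3 x≤Mᵏ ⟩
  (M ^ k) ^ 3  ≡⟨ ^-*-assoc M k 3 ⟩
  M ^ (k ℕ.* 3) ≡⟨ cong (M ^_) (*-comm k 3) ⟩
  M ^ (3 ℕ.* k) ≡⟨ sym (^-*-assoc M 3 k) ⟩
  (M ^ 3) ^ k  <⟨ ^-monoˡ-< k (n<1+n (M ^ 3)) ⟩
  suc (M ^ 3) ^ k ∎
  where open ≤-Reasoning

lemma4 : (d : ℕ) → 2 ≤ d → (α : ℕ → ℤ) → α d ≢ 0ℤ → (s : ℕ → ℕ) → Recurrence d α s →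
    ∃ λ (b : ℕ) → ∀ (k : ℕ) → d ∸ 1 ≤ k → ∀ (i : ℕ) → i < d →
      ∣ c d α s i k ∣ ^ 3 < b ^ k
lemma4 d 2≤d α _ s rec with c-exp-bound α s (≤-trans (s≤s z≤n) 2≤d) rec
... | M , c≤Mᵏ = suc (M ^ 3) , bound
  where
  bound : ∀ k → d ∸ 1 ≤ k → ∀ i → i < d → ∣ c d α s i k ∣ ^ 3 < suc (M ^ 3) ^ k
  bound k d∸1≤k i i<d = cube<pow M k {{k≢0}} (c≤Mᵏ k {{k≢0}} i i<d)
    where
    k≢0 : NonZero k
    k≢0 = >-nonZero (≤-trans (∸-monoˡ-≤ 1 2≤d) d∸1≤k)
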